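{- Let $S,S'\subseteq\omega$ be infinite sets containing $0$ which both satisfy condition (M) (for $T\in\{S,S'\}$: for every $p\in\omega$ there is $k\in\omega$ such that for every $q\in\omega$ there is $c\in\omega\cap[q,q+k]$ with $c+(T\cap[0,p])=T\cap(c+[0,p])$). Then: (a) if there is $p\in\omega$ such that for all $c\in\omega$, $c+(S\cap[0,p])\neq S'\cap(c+[0,p])$, then $A^S\not\leq^r_c A^{S'}$ and $A^{S'}\not\leq^r_c A^S$; (b) if there is $p\in\omega$ such that for all $c\in\omega$, $c-(S\cap[0,p])\neq S'\cap(c-[0,p])$, then $A^S\not\leq^r_c (A^{S'})^{ -1}$ and $(A^{S'})^{ -1}\not\leq^r_c A^S$.
   Context: For $c\in\omega$ and $F\subseteq\omega$: $c+F:=\{c+m:m\in F\}$, $c-F:=\{c-m:m\in F\}$ (as subsets of $\mathbb{Z}$). For $s\in 2^{<\omega}$, $\mathrm{Card}(s)$ is the number of $1$'s in $s$; $A^S:=\{(s0\gamma,s1\gamma): s\in 2^{<\omega},\ \mathrm{Card}(s)\in S,\ \gamma\in 2^\omega\}\subseteq 2^\omega\times 2^\omega$, and $(A^{S'})^{ -1}:=\{(y,x):(x,y)\in A^{S'}\}$. For $A\subseteq 2^\omega\times 2^\omega$ and $A'\subseteq 2^\omega\times 2^\omega$, $A\leq^r_c A'$ means there are continuous $u,v:2^\omega\to 2^\omega$ with $A=(u\times v)^{ -1}(A')$. -}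

module Defs where

open import Data.Nat using (ℕ; zero; suc; _+_; _≤_; _<_)
open import Data.Integer using (ℤ; +_; _-_)
open import Data.Bool using (Bool; true; false)
open import Data.List using (List; []; _∷_; _++_)
open import Data.Product using (Σ; ∃; _×_; _,_)
open import Relation.Binary.PropositionalEquality using (_≡_)
open import Relation.Nullary using (¬_)

Subset : Set₁
Subset = ℕ → Set

ZSubset : Set₁
ZSubset = ℤ → Set

_∩_ : Subset → Subset → Subset
(P ∩ Q) n = P n × Q n

[0,_] : ℕ → Subset
[0, p ] m = m ≤ p

_⊕_ : ℕ → Subset → Subset
(c ⊕ F) n = Σ ℕ λ m → F m × (n ≡ c + m)

_⊖_ : ℕ → Subset → ZSubset
(c ⊖ F) z = Σ ℕ λ m → F m × (z ≡ (+ c) - (+ m))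

toZ : Subset → ZSubset
toZ F z = Σ ℕ λ n → F n × (z ≡ + n)

_∩ᶻ_ : ZSubset → ZSubset → ZSubset
(P ∩ᶻ Q) z = P z × Q z

_≐_ : Subset → Subset → Set
P ≐ Q = ∀ n → (P n → Q n) × (Q n → P n)

_≐ᶻ_ : ZSubset → ZSubset → Set
P ≐ᶻ Q = ∀ z → (P z → Q z) × (Q z → P z)

Infinite : Subset → Set
Infinite T = ∀ n → Σ ℕ λ m → n ≤ m × T m

CondM : Subset → Set
CondM T = ∀ p → Σ ℕ λ k → ∀ q → Σ ℕ λ c →
  (q ≤ c) × (c ≤ q + k) × ((c ⊕ (T ∩ [0, p ])) ≐ (T ∩ (c ⊕ [0, p ])))

Cantor : Set
Cantor = ℕ → Bool

prepend : List Bool → Cantor → Cantor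
prepend [] γ n = γ n
prepend (b ∷ s) γ zero = b
prepend (b ∷ s) γ (suc n) = prepend s γ n

Card : List Bool → ℕ
Card [] = 0
Card (true ∷ s) = suc (Card s)
Card (false ∷ s) = Card s

Rel2 : Set₁
Rel2 = Cantor → Cantor → Set

A^ : Subset → Rel2
A^ S x y = Σ (List Bool) λ s → Σ Cantor λ γ →
  S (Card s)
  × (∀ i → x i ≡ prepend (s ++ false ∷ []) γ i)
  × (∀ i → y i ≡ prepend (s ++ true ∷ []) γ i)

_⁻¹ : Rel2 → Rel2
(A ⁻¹) x y = A y x

Continuous : (Cantor → Cantor) → Set
Continuous u = ∀ x n → Σ ℕ λ m → ∀ y →
  (∀ i → i < m → x i ≡ y i) → ∀ i → i < n → u x i ≡ u y i

_≤rc_ : Rel2 → Rel2 → Set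
A ≤rc A' = Σ (Cantor → Cantor) λ u → Σ (Cantor → Cantor) λ v →
  Continuous u × Continuous v ×
  (∀ x y → (A x y → A' (u x) (v y)) × (A' (u x) (v y) → A x y))

-- A^T relates x to the point obtained by raising a 0 of x to 1 at a position preceded by a number of
-- ones lying in T, so a continuous reduction (u, v) maps these T-edges onto T'-edges (reversed ones for
-- (A^T')⁻¹) and back.  As T is infinite, every point is a limit of points with T-edges leaving at all late
-- positions, which forces u = v.  Raising the first a bits of 0^ω one at a time, each time with 0 ∈ T ones
-- before, shows that u(1^a 0^ω) arises from u(0^ω) by raising exactly a bits, all of them (for a ≤ P)
-- before a common bound R.  Raising in addition a far bit l is a T-edge from 1^a 0^ω iff a ∈ T, and its
-- image raises one fixed bit β ≥ R preceded by κ + a ones (κ − a in the reversed case).  Hence S ∩ [0,p]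
-- is a shifted (reflected) copy of a block of S'; for reductions in the other direction the roles swap,
-- and condition (M) for S moves a copy of S ∩ [0,p] onto the block found.

module Submission where

open import Defs

open import Data.Bool using (Bool; true; false; not; if_then_else_; _xor_)
open import Data.Bool.Properties using (not-involutive; not-¬; not-distribˡ-xor; xor-same) renaming (_≟_ to _≟ᵇ_)
open import Data.Integer as ℤ using (_-_)
import Data.Integer.Properties as ℤₚ
open import Data.List using (List; []; _∷_; _++_; length)
open import Data.Nat using (ℕ; zero; suc; _+_; _⊔_; _≤_; _<_; z≤n; _<?_; _≤?_)
open import Data.Nat.Properties
open import Algebra.Properties.CommutativeSemigroup +-commutativeSemigroup using (interchange; x∙yz≈y∙xz)
open import Data.Product using (Σ; ∃; _×_; _,_; proj₁; proj₂)
open import Data.Sum using (_⊎_; inj₁; inj₂)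
open import Function using (_⇔_; mk⇔; Equivalence)
open import Function.Properties.Equivalence using (⇔-setoid)
open import Level using (0ℓ)
open import Relation.Binary.PropositionalEquality
import Relation.Binary.Reasoning.Setoid as SetoidReasoning
open import Relation.Nullary using (¬_; does; yes; no; contradiction)
open import Relation.Nullary.Decidable using (dec-true; dec-false)

infix 4 _≈_

_≈_ : Cantor → Cantor → Set
x ≈ y = ∀ j → x j ≡ y j

AgreeBelow : ℕ → Cantor → Cantor → Set
AgreeBelow n x y = ∀ j → j < n → x j ≡ y j

ZeroFrom : ℕ → Cantor → Set
ZeroFrom n x = ∀ j → n ≤ j → x j ≡ false

Eventually : (ℕ → Set) → Set
Eventually P = ∃ λ N → ∀ n → N ≤ n → P n

eventually-both : ∀ {P Q} → Eventually P → Eventually Q → Eventually (λ n → P n × Q n)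
eventually-both (M , p) (N , q) =
  M ⊔ N , λ n MN≤n → p n (≤-trans (m≤m⊔n M N) MN≤n) , q n (≤-trans (m≤n⊔m M N) MN≤n)

eventually-all≤ : ∀ {Q : ℕ → ℕ → Set} P → (∀ a → a ≤ P → Eventually (Q a)) →
                  Eventually (λ n → ∀ a → a ≤ P → Q a n)
eventually-all≤ zero ev with ev 0 z≤n
... | N , q = N , λ { n N≤n .zero z≤n → q n N≤n }
eventually-all≤ {Q} (suc P) ev
  with eventually-both (eventually-all≤ P (λ a a≤P → ev a (m≤n⇒m≤1+n a≤P))) (ev (suc P) ≤-refl)
... | N , q = N , λ n N≤n a a≤1+P → below-or-top n a a≤1+P (q n N≤n)
  where
  below-or-top : ∀ n a → a ≤ suc P → (∀ a → a ≤ P → Q a n) × Q (suc P) n → Q a n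
  below-or-top n a a≤1+P (below , top) with m≤n⇒m<n∨m≡n a≤1+P
  ... | inj₁ a<1+P = below a (≤-pred a<1+P)
  ... | inj₂ refl  = top

toggle : Cantor → ℕ → Cantor
toggle x m j = if does (j ≟ m) then not (x j) else x j

toggle-at : ∀ x m → toggle x m m ≡ not (x m)
toggle-at x m = cong (if_then not (x m) else x m) (dec-true (m ≟ m) refl)

toggle-away : ∀ x {m j} → j ≢ m → toggle x m j ≡ x j
toggle-away x {m} {j} j≢m = cong (if_then not (x j) else x j) (dec-false (j ≟ m) j≢m)

toggle-cong : ∀ {x y} m {j} → x j ≡ y j → toggle x m j ≡ toggle y m j
toggle-cong m {j} xj≡yj = cong (λ c → if does (j ≟ m) then not c else c) xj≡yj

toggle-resp : ∀ {x y} m → x ≈ y → toggle x m ≈ toggle y m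
toggle-resp {x} {y} m x≈y j = toggle-cong {x} {y} m {j} (x≈y j)

toggle-below : ∀ x {m j} → j < m → toggle x m j ≡ x j
toggle-below x j<m = toggle-away x (<⇒≢ j<m)

toggle-involutive : ∀ x m → toggle (toggle x m) m ≈ x
toggle-involutive x m j with j ≟ m
... | yes refl = trans (toggle-at (toggle x j) j) (trans (cong not (toggle-at x j)) (not-involutive (x j)))
... | no j≢m   = trans (toggle-away (toggle x m) j≢m) (toggle-away x j≢m)

toggle-comm : ∀ x m l → toggle (toggle x m) l ≈ toggle (toggle x l) m
toggle-comm x m l j with j ≟ m | j ≟ l
... | yes refl | yes refl = refl
... | yes refl | no j≢l   = begin
  toggle (toggle x j) l j ≡⟨ toggle-away (toggle x j) j≢l ⟩
  toggle x j j            ≡⟨ toggle-at x j ⟩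
  not (x j)               ≡⟨ cong not (toggle-away x j≢l) ⟨
  not (toggle x l j)      ≡⟨ toggle-at (toggle x l) j ⟨
  toggle (toggle x l) j j ∎
  where open ≡-Reasoning
... | no j≢m   | yes refl = begin
  toggle (toggle x m) j j ≡⟨ toggle-at (toggle x m) j ⟩
  not (toggle x m j)      ≡⟨ cong not (toggle-away x j≢m) ⟩
  not (x j)               ≡⟨ toggle-at x j ⟨
  toggle x j j            ≡⟨ toggle-away (toggle x j) j≢m ⟨
  toggle (toggle x j) m j ∎
  where open ≡-Reasoning
... | no j≢m   | no j≢l   = begin
  toggle (toggle x m) l j ≡⟨ toggle-away (toggle x m) j≢l ⟩
  toggle x m j            ≡⟨ toggle-away x j≢m ⟩
  x j                     ≡⟨ toggle-away x j≢l ⟨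
  toggle x l j            ≡⟨ toggle-away (toggle x l) j≢m ⟨
  toggle (toggle x l) m j ∎
  where open ≡-Reasoning

toggle-moves : ∀ x {m j} → toggle x m j ≢ x j → m ≡ j
toggle-moves x {m} {j} moved with j ≟ m
... | yes j≡m = sym j≡m
... | no j≢m  = contradiction (toggle-away x j≢m) moved

toggle-splice : ∀ {R β U V W W'} → R ≤ β → V ≈ toggle U β → AgreeBelow R W W' →
  (∀ j → R ≤ j → U j ≡ W j) → (∀ j → R ≤ j → V j ≡ W' j) → W' ≈ toggle W β
toggle-splice {R} {β} {U} {V} {W} {W'} R≤β V≈ W≈W' U≡W V≡W' j with R ≤? j
... | yes R≤j = trans (sym (V≡W' j R≤j)) (trans (V≈ j) (toggle-cong {U} {W} β (U≡W j R≤j)))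
... | no  R≰j = trans (sym (W≈W' j (≰⇒> R≰j))) (sym (toggle-below W (<-≤-trans (≰⇒> R≰j) R≤β)))

bit : Bool → ℕ
bit true  = 1
bit false = 0

ones : Cantor → ℕ → ℕ
ones x zero    = 0
ones x (suc n) = ones x n + bit (x n)

ones-cong : ∀ n {x y} → AgreeBelow n x y → ones x n ≡ ones y n
ones-cong zero    _   = refl
ones-cong (suc n) x≈y = cong₂ _+_ (ones-cong n (λ j j<n → x≈y j (m<n⇒m<1+n j<n))) (cong bit (x≈y n ≤-refl))

ones-suc-head : ∀ x n → ones x (suc n) ≡ bit (x 0) + ones (λ i → x (suc i)) n
ones-suc-head x zero    = +-comm 0 (bit (x 0))
ones-suc-head x (suc n) = trans (cong (_+ bit (x (suc n))) (ones-suc-head x n)) (+-assoc (bit (x 0)) _ _)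

ones-mono : ∀ x {m n} → m ≤ n → ones x m ≤ ones x n
ones-mono x {n = zero}  z≤n = ≤-refl
ones-mono x {m} {suc n} m≤1+n with m≤n⇒m<n∨m≡n m≤1+n
... | inj₁ m<1+n = ≤-trans (ones-mono x (≤-pred m<1+n)) (m≤m+n _ _)
... | inj₂ refl  = ≤-refl

ones-stable : ∀ x {L} → ZeroFrom L x → ∀ {n} → L ≤ n → ones x n ≡ ones x L
ones-stable x zero-from {zero} z≤n = refl
ones-stable x {L} zero-from {suc n} L≤1+n with m≤n⇒m<n∨m≡n L≤1+n
... | inj₁ L<1+n = trans (cong (ones x n +_) (cong bit (zero-from n (≤-pred L<1+n))))
                         (trans (+-identityʳ _) (ones-stable x zero-from (≤-pred L<1+n)))
... | inj₂ refl  = refl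

ones-all-false : ∀ x n → (∀ j → j < n → x j ≡ false) → ones x n ≡ 0
ones-all-false x zero    _     = refl
ones-all-false x (suc n) x<n≡false
  rewrite ones-all-false x n (λ j j<n → x<n≡false j (m<n⇒m<1+n j<n)) | x<n≡false n ≤-refl = refl

ones-all-true : ∀ x n → (∀ j → j < n → x j ≡ true) → ones x n ≡ n
ones-all-true x zero    _    = refl
ones-all-true x (suc n) x<n≡true
  rewrite ones-all-true x n (λ j j<n → x<n≡true j (m<n⇒m<1+n j<n)) | x<n≡true n ≤-refl = +-comm n 1

ones-toggle : ∀ x {m} → x m ≡ false → ∀ {n} → m < n → ones (toggle x m) n ≡ suc (ones x n)
ones-toggle x {m} xm≡false {suc n} m<1+n with m≤n⇒m<n∨m≡n (≤-pred m<1+n)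
... | inj₁ m<n = begin
  ones (toggle x m) n + bit (toggle x m n) ≡⟨ cong₂ _+_ (ones-toggle x xm≡false m<n) (cong bit (toggle-away x (>⇒≢ m<n))) ⟩
  suc (ones x n) + bit (x n)               ∎
  where open ≡-Reasoning
... | inj₂ refl = begin
  ones (toggle x m) m + bit (toggle x m m) ≡⟨ cong₂ _+_ (ones-cong m (λ j → toggle-below x)) (cong bit (toggle-at x m)) ⟩
  ones x m + bit (not (x m))               ≡⟨ cong (λ c → ones x m + bit (not c)) xm≡false ⟩
  ones x m + 1                             ≡⟨ +-comm (ones x m) 1 ⟩
  suc (ones x m)                           ≡⟨ cong suc (sym (+-identityʳ _)) ⟩
  suc (ones x m + 0)                       ≡⟨ cong (λ c → suc (ones x m + bit c)) (sym xm≡false) ⟩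
  suc (ones x m + bit (x m))               ∎
  where open ≡-Reasoning

-- A^T x y says exactly that y arises from x by raising a bit at a position m with ones x m ∈ T;
-- Edge true T is the reversed relation.
record EdgeAt (b : Bool) (T : Subset) (m : ℕ) (x y : Cantor) : Set where
  constructor edgeAt
  field
    source-bit : x m ≡ b
    target     : y ≈ toggle x m
    count      : T (ones x m)

Edge : Bool → Subset → Cantor → Cantor → Set
Edge b T x y = ∃ λ m → EdgeAt b T m x y

toggle-edge : ∀ {T} x {m} → x m ≡ false → T (ones x m) → Edge false T x (toggle x m)
toggle-edge x {m} xm≡false Tm = m , edgeAt xm≡false (λ j → refl) Tm

edge-position : ∀ {b T m x y i} → EdgeAt b T m x y → x i ≢ y i → m ≡ i
edge-position {x = x} (edgeAt _ y≈ _) xi≢yi = toggle-moves x (λ moved → xi≢yi (sym (trans (y≈ _) moved)))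

Edge⇒EdgeAt : ∀ {b T x y m} → Edge b T x y → y ≈ toggle x m → EdgeAt b T m x y
Edge⇒EdgeAt {b} {T} {x} {y} {m} (m' , e) y≈ = subst (λ k → EdgeAt b T k x y) (edge-position e xm≢ym) e
  where
  xm≢ym : x m ≢ y m
  xm≢ym xm≡ym = not-¬ refl (trans xm≡ym (trans (y≈ m) (toggle-at x m)))

edge-irreflexive : ∀ {b T x} → ¬ Edge b T x x
edge-irreflexive {x = x} (m , edgeAt _ x≈ _) = not-¬ refl (trans (x≈ m) (toggle-at x m))

edge-reverse : ∀ {b T x y} → Edge b T x y → Edge (not b) T y x
edge-reverse {b} {T} {x} {y} (m , edgeAt xm≡b y≈ Tm) =
  m , edgeAt
  (trans (y≈ m) (trans (toggle-at x m) (cong not xm≡b)))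
  (λ j → sym (trans (toggle-resp m y≈ j) (toggle-involutive x m j)))
  (subst T (ones-cong m (λ j j<m → sym (trans (y≈ j) (toggle-below x j<m)))) Tm)

edge-respʳ : ∀ {b T x y y'} → y ≈ y' → Edge b T x y → Edge b T x y'
edge-respʳ y≈y' (m , edgeAt xm≡b y≈ Tm) = m , edgeAt xm≡b (λ j → trans (sym (y≈y' j)) (y≈ j)) Tm

prefix : ℕ → Cantor → List Bool
prefix zero    x = []
prefix (suc m) x = x 0 ∷ prefix m (λ i → x (suc i))

shift : ℕ → Cantor → Cantor
shift m x i = x (m + i)

prepend-last : ∀ s r γ → prepend (s ++ r ∷ []) γ (length s) ≡ r
prepend-last []      r γ = refl
prepend-last (_ ∷ s) r γ = prepend-last s r γ

prepend-toggle : ∀ s γ → prepend (s ++ true ∷ []) γ ≈ toggle (prepend (s ++ false ∷ []) γ) (length s)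
prepend-toggle []      γ zero    = refl
prepend-toggle []      γ (suc j) = refl
prepend-toggle (_ ∷ s) γ zero    = refl
prepend-toggle (_ ∷ s) γ (suc j) = prepend-toggle s γ j

ones-prepend : ∀ s r γ → ones (prepend (s ++ r ∷ []) γ) (length s) ≡ Card s
ones-prepend []          r γ = refl
ones-prepend (true ∷ s)  r γ = trans (ones-suc-head _ (length s)) (cong suc (ones-prepend s r γ))
ones-prepend (false ∷ s) r γ = trans (ones-suc-head _ (length s)) (ones-prepend s r γ)

prepend-prefix : ∀ m x → x m ≡ false → x ≈ prepend (prefix m x ++ false ∷ []) (shift (suc m) x)
prepend-prefix zero    x x0≡false zero    = x0≡false
prepend-prefix zero    x _        (suc i) = refl
prepend-prefix (suc m) x _        zero    = refl
prepend-prefix (suc m) x xm≡false (suc i) = prepend-prefix m (λ i → x (suc i)) xm≡false i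

prepend-prefix-toggle : ∀ m x → x m ≡ false → toggle x m ≈ prepend (prefix m x ++ true ∷ []) (shift (suc m) x)
prepend-prefix-toggle zero    x x0≡false zero    = cong not x0≡false
prepend-prefix-toggle zero    x _        (suc i) = refl
prepend-prefix-toggle (suc m) x _        zero    = refl
prepend-prefix-toggle (suc m) x xm≡false (suc i) = prepend-prefix-toggle m (λ i → x (suc i)) xm≡false i

Card-∷ : ∀ b s → bit b + Card s ≡ Card (b ∷ s)
Card-∷ true  s = refl
Card-∷ false s = refl

Card-prefix : ∀ m x → Card (prefix m x) ≡ ones x m
Card-prefix zero    x = refl
Card-prefix (suc m) x = begin
  Card (prefix (suc m) x)                        ≡⟨ Card-∷ (x 0) _ ⟨
  bit (x 0) + Card (prefix m (λ i → x (suc i))) ≡⟨ cong (bit (x 0) +_) (Card-prefix m _) ⟩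
  bit (x 0) + ones (λ i → x (suc i)) m          ≡⟨ ones-suc-head x m ⟨
  ones x (suc m)                                 ∎
  where open ≡-Reasoning

A^⇒Edge : ∀ {T x y} → A^ T x y → Edge false T x y
A^⇒Edge {T} {x} {y} (s , γ , Ts , x≈ , y≈) =
  length s , edgeAt
  (trans (x≈ (length s)) (prepend-last s false γ))
  (λ j → trans (y≈ j) (trans (prepend-toggle s γ j) (sym (toggle-resp (length s) x≈ j))))
  (subst T (sym (trans (ones-cong (length s) (λ j _ → x≈ j)) (ones-prepend s false γ))) Ts)

Edge⇒A^ : ∀ {T x y} → Edge false T x y → A^ T x y
Edge⇒A^ {T} {x} (m , edgeAt xm≡false y≈ Tm) =
  prefix m x , shift (suc m) x , subst T (sym (Card-prefix m x)) Tm ,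
  prepend-prefix m x xm≡false , (λ j → trans (y≈ j) (prepend-prefix-toggle m x xm≡false j))

Reduction : Bool → Subset → Subset → (Cantor → Cantor) → (Cantor → Cantor) → Set
Reduction b T T' u v =
  ∀ x y → (Edge false T x y → Edge b T' (u x) (v y)) × (Edge b T' (u x) (v y) → Edge false T x y)

reduction-A^ : ∀ {T T' u v} →
  (∀ x y → (A^ T x y → A^ T' (u x) (v y)) × (A^ T' (u x) (v y) → A^ T x y)) → Reduction false T T' u v
reduction-A^ red x y =
  (λ e → A^⇒Edge (proj₁ (red x y) (Edge⇒A^ e))) ,
  (λ e → A^⇒Edge (proj₂ (red x y) (Edge⇒A^ e)))

reduction-A^⁻¹ : ∀ {T T' u v} →
  (∀ x y → (A^ T x y → (A^ T' ⁻¹) (u x) (v y)) × ((A^ T' ⁻¹) (u x) (v y) → A^ T x y)) → Reduction true T T' u v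
reduction-A^⁻¹ red x y =
  (λ e → edge-reverse (A^⇒Edge (proj₁ (red x y) (Edge⇒A^ e)))) ,
  (λ e → A^⇒Edge (proj₂ (red x y) (Edge⇒A^ (edge-reverse e))))

reduction-⁻¹A^ : ∀ {T T' u v} →
  (∀ x y → ((A^ T ⁻¹) x y → A^ T' (u x) (v y)) × (A^ T' (u x) (v y) → (A^ T ⁻¹) x y)) → Reduction true T T' v u
reduction-⁻¹A^ red x y =
  (λ e → edge-reverse (A^⇒Edge (proj₁ (red y x) (Edge⇒A^ e)))) ,
  (λ e → A^⇒Edge (proj₂ (red y x) (Edge⇒A^ (edge-reverse e))))

continuity-eventually : ∀ {u} → Continuous u → ∀ x n →
  Eventually (λ M → ∀ y → AgreeBelow M x y → AgreeBelow n (u x) (u y))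
continuity-eventually cu x n with cu x n
... | M , agree = M , λ M' M≤M' y x≈y → agree y (λ i i<M → x≈y i (≤-trans i<M M≤M'))

continuous-at-toggles : ∀ {u} → Continuous u → ∀ x j → Eventually (λ n → u (toggle x n) j ≡ u x j)
continuous-at-toggles {u} cu x j with continuity-eventually cu x (suc j)
... | M , agree = M , λ n M≤n → sym (agree n M≤n (toggle x n) (λ i i<n → sym (toggle-below x i<n)) j ≤-refl)

edge-limit : ∀ {b T x y} (ys : ℕ → Cantor) {i} → x i ≢ y i →
  Eventually (λ n → Edge b T x (ys n)) → (∀ j → Eventually (λ n → ys n j ≡ y j)) → Edge b T x y
edge-limit {b} {T} {x} {y} ys {i} xi≢yi edges ys→y = i , edgeAt xi≡b y≈ Ti
  where
  at-i : Eventually (λ n → EdgeAt b T i x (ys n))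
  at-i with eventually-both edges (ys→y i)
  ... | N , h = N , λ n N≤n →
    let (m , e) , ysi≡yi = h n N≤n
    in subst (λ k → EdgeAt b T k x (ys n)) (edge-position e (λ xi≡ysi → xi≢yi (trans xi≡ysi ysi≡yi))) e
  xi≡b : x i ≡ b
  xi≡b = EdgeAt.source-bit (proj₂ at-i _ ≤-refl)
  Ti : T (ones x i)
  Ti = EdgeAt.count (proj₂ at-i _ ≤-refl)
  y≈ : y ≈ toggle x i
  y≈ j with eventually-both at-i (ys→y j)
  ... | N , h = let edgeAt _ ys≈ _ , ysj≡yj = h N ≤-refl in trans (sym ysj≡yj) (ys≈ j)

-- Toggling y at a late position n is a T-edge, so u y is joined to v (toggle y n) for all large n; these
-- converge to v y, so u y ≠ v y would yield an edge from u y to v y, which reflects to a loop at y.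
reduction-diagonal-finite : ∀ {b T T' u v} → Continuous v → Reduction b T T' u v →
  ∀ y L → ZeroFrom L y → T (ones y L) → u y ≈ v y
reduction-diagonal-finite {b} {T} {T'} {u} {v} cv red y L y≥L≡false TL i with u y i ≟ᵇ v y i
... | yes uyi≡vyi = uyi≡vyi
... | no  uyi≢vyi =
  contradiction (proj₂ (red y y) (edge-limit (λ n → v (toggle y n)) uyi≢vyi edges (continuous-at-toggles cv y)))
                edge-irreflexive
  where
  edges : Eventually (λ n → Edge b T' (u y) (v (toggle y n)))
  edges = L , λ n L≤n → proj₁ (red y (toggle y n))
    (toggle-edge y (y≥L≡false n L≤n) (subst T (sym (ones-stable y y≥L≡false L≤n)) TL))

pad : Cantor → ℕ → ℕ → Cantor
pad x M d j = if does (j <? M) then x j else does (j <? M + d)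

pad-agree : ∀ x M d → AgreeBelow M x (pad x M d)
pad-agree x M d j j<M = sym (cong (if_then x j else does (j <? M + d)) (dec-true (j <? M) j<M))

pad-zero : ∀ x M d → ZeroFrom (M + d) (pad x M d)
pad-zero x M d j M+d≤j =
  trans (cong (if_then x j else does (j <? M + d)) (dec-false (j <? M) (≤⇒≯ (≤-trans (m≤m+n M d) M+d≤j))))
        (dec-false (j <? M + d) (≤⇒≯ M+d≤j))

ones-pad : ∀ x M d {e} → e ≤ d → ones (pad x M d) (M + e) ≡ ones x M + e
ones-pad x M d {zero} _ = begin
  ones (pad x M d) (M + 0) ≡⟨ cong (ones (pad x M d)) (+-identityʳ M) ⟩
  ones (pad x M d) M       ≡⟨ ones-cong M (pad-agree x M d) ⟨
  ones x M                 ≡⟨ +-identityʳ _ ⟨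
  ones x M + 0             ∎
  where open ≡-Reasoning
ones-pad x M d {suc e} e<d = begin
  ones (pad x M d) (M + suc e)                   ≡⟨ cong (ones (pad x M d)) (+-suc M e) ⟩
  ones (pad x M d) (M + e) + bit (pad x M d (M + e)) ≡⟨ cong₂ _+_ (ones-pad x M d (<⇒≤ e<d)) (cong bit pad-one) ⟩
  ones x M + e + 1                               ≡⟨ +-assoc (ones x M) e 1 ⟩
  ones x M + (e + 1)                             ≡⟨ cong (ones x M +_) (+-comm e 1) ⟩
  ones x M + suc e                               ∎
  where
  open ≡-Reasoning
  pad-one : pad x M d (M + e) ≡ true
  pad-one = trans (cong (if_then x (M + e) else does (M + e <? M + d)) (dec-false (M + e <? M) (≤⇒≯ (m≤m+n M e))))
                  (dec-true (M + e <? M + d) (+-monoʳ-< M e<d))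

reduction-diagonal : ∀ {b T T' u v} → Continuous u → Continuous v → Reduction b T T' u v →
  Infinite T → ∀ x → u x ≈ v x
reduction-diagonal {T = T} {u = u} {v} cu cv red infT x i
  with eventually-both (continuity-eventually cu x (suc i)) (continuity-eventually cv x (suc i))
... | M , near-x with infT (ones x M)
... | t , ones≤t , Tt with m≤n⇒∃[o]m+o≡n ones≤t
... | d , refl = begin
  u x i ≡⟨ proj₁ (near-x M ≤-refl) y (pad-agree x M d) i ≤-refl ⟩
  u y i ≡⟨ reduction-diagonal-finite cv red y (M + d) (pad-zero x M d) Ty i ⟩
  v y i ≡⟨ proj₂ (near-x M ≤-refl) y (pad-agree x M d) i ≤-refl ⟨
  v x i ∎
  where
  open ≡-Reasoning
  y : Cantor
  y = pad x M d
  Ty : T (ones y (M + d))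
  Ty = subst T (sym (ones-pad x M d ≤-refl)) Tt

data Flips (b : Bool) : ℕ → Cantor → Cantor → Set where
  flips-none : ∀ {x y} → x ≈ y → Flips b 0 x y
  flips-step : ∀ {a x y} m → x m ≡ b → Flips b a (toggle x m) y → Flips b (suc a) x y

flips-respˡ : ∀ {b a x x' y} → x ≈ x' → Flips b a x y → Flips b a x' y
flips-respˡ x≈x' (flips-none x≈y)        = flips-none (λ j → trans (sym (x≈x' j)) (x≈y j))
flips-respˡ x≈x' (flips-step m xm≡b rest) =
  flips-step m (trans (sym (x≈x' m)) xm≡b) (flips-respˡ (toggle-resp m x≈x') rest)

ChangesFrom : Bool → Cantor → Cantor → Set
ChangesFrom b x y = ∀ j → x j ≡ y j ⊎ (x j ≡ b × y j ≡ not b)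

flips-changes : ∀ {b a x y} → Flips b a x y → ChangesFrom b x y
flips-changes (flips-none x≈y) j = inj₁ (x≈y j)
flips-changes {b} {x = x} {y} (flips-step m xm≡b rest) j with j ≟ m | flips-changes rest j
... | yes refl | inj₁ toggled≡y      = inj₂ (xm≡b , trans (sym toggled≡y) (trans (toggle-at x j) (cong not xm≡b)))
... | yes refl | inj₂ (toggled≡b , _) =
  contradiction (trans (sym toggled≡b) (trans (toggle-at x j) (cong not xm≡b))) (not-¬ refl)
... | no j≢m | inj₁ toggled≡y        = inj₁ (trans (sym (toggle-away x j≢m)) toggled≡y)
... | no j≢m | inj₂ (toggled≡b , yj) = inj₂ (trans (sym (toggle-away x j≢m)) toggled≡b , yj)

diff : Cantor → Cantor → Cantor
diff x y j = x j xor y j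

diff-toggle : ∀ x y m → diff (toggle x m) y ≈ toggle (diff x y) m
diff-toggle x y m j with j ≟ m
... | yes refl = trans (cong (_xor y j) (toggle-at x j)) (trans (sym (not-distribˡ-xor (x j) (y j))) (sym (toggle-at (diff x y) j)))
... | no j≢m   = trans (cong (_xor y j) (toggle-away x j≢m)) (sym (toggle-away (diff x y) j≢m))

xor≡false⇒≡ : ∀ p q → p xor q ≡ false → p ≡ q
xor≡false⇒≡ false false _ = refl
xor≡false⇒≡ true  true  _ = refl

flips-diff : ∀ {b a x y} → Flips b a x y → Eventually (λ n → ones (diff x y) n ≡ a)
flips-diff {x = x} {y} (flips-none x≈y) =
  0 , λ n _ → ones-all-false (diff x y) n (λ j _ → trans (cong (_xor y j) (x≈y j)) (xor-same (y j)))
flips-diff {b} {suc a} {x} {y} (flips-step m xm≡b rest) with flips-diff rest | flips-changes rest m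
... | N , ones≡a | inj₂ (toggled≡b , _) =
  contradiction (trans (sym toggled≡b) (trans (toggle-at x m) (cong not xm≡b))) (not-¬ refl)
... | N , ones≡a | inj₁ toggled≡y = N ⊔ suc m , λ n N⊔m<n → begin
  ones (diff x y) n                          ≡⟨ ones-cong n (λ j _ → diff-untoggle j) ⟩
  ones (toggle (diff (toggle x m) y) m) n    ≡⟨ ones-toggle (diff (toggle x m) y) rest-diff-m (≤-trans (m≤n⊔m N (suc m)) N⊔m<n) ⟩
  suc (ones (diff (toggle x m) y) n)         ≡⟨ cong suc (ones≡a n (≤-trans (m≤m⊔n N (suc m)) N⊔m<n)) ⟩
  suc a                                      ∎
  where
  open ≡-Reasoning
  rest-diff-m : diff (toggle x m) y m ≡ false
  rest-diff-m = trans (cong (_xor y m) toggled≡y) (xor-same (y m))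
  diff-untoggle : diff x y ≈ toggle (diff (toggle x m) y) m
  diff-untoggle j = trans (cong (_xor y j) (sym (toggle-involutive x m j))) (diff-toggle (toggle x m) y m j)

ones-saturated : ∀ z {a R} → Eventually (λ n → ones z n ≡ a) → ones z R ≡ a → ZeroFrom R z
ones-saturated z {a} {R} (N , ones≡a) onesR≡a j R≤j with z j in zj
... | false = refl
... | true  = contradiction (begin-strict
  a                     ≡⟨ onesR≡a ⟨
  ones z R              ≤⟨ ones-mono z R≤j ⟩
  ones z j              <⟨ n<1+n _ ⟩
  suc (ones z j)        ≡⟨ +-comm 1 (ones z j) ⟩
  ones z j + bit true   ≡⟨ cong (λ c → ones z j + bit c) zj ⟨
  ones z (suc j)        ≤⟨ ones-mono z (m≤n⊔m N (suc j)) ⟩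
  ones z (N ⊔ suc j)    ≡⟨ ones≡a _ (m≤m⊔n N (suc j)) ⟩
  a                     ∎) (<-irrefl refl)
  where open ≤-Reasoning

flips-agree-from : ∀ {b a x y R} → Flips b a x y → ones (diff x y) R ≡ a → ∀ j → R ≤ j → x j ≡ y j
flips-agree-from {x = x} {y} f onesR≡a j R≤j = xor≡false⇒≡ (x j) (y j) (ones-saturated (diff x y) (flips-diff f) onesR≡a j R≤j)

Offset : Bool → ℕ → ℕ → ℕ → Set
Offset false κ a c = c ≡ κ + a
Offset true  κ a c = c + a ≡ κ

offset-+ : ∀ b {κ a c κ' a' c'} → Offset b κ a c → Offset b κ' a' c' → Offset b (κ + κ') (a + a') (c + c')
offset-+ false {κ} {a} {c} {κ'} {a'} {c'} c≡κ+a c'≡κ'+a' = begin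
  c + c'               ≡⟨ cong₂ _+_ c≡κ+a c'≡κ'+a' ⟩
  κ + a + (κ' + a')    ≡⟨ interchange κ a κ' a' ⟩
  κ + κ' + (a + a')    ∎
  where open ≡-Reasoning
offset-+ true {κ} {a} {c} {κ'} {a'} {c'} c+a≡κ c'+a'≡κ' = begin
  c + c' + (a + a')    ≡⟨ interchange c c' a a' ⟩
  c + a + (c' + a')    ≡⟨ cong₂ _+_ c+a≡κ c'+a'≡κ' ⟩
  κ + κ'               ∎
  where open ≡-Reasoning

offset-bit : ∀ b {p q} → p ≡ q ⊎ (p ≡ b × q ≡ not b) → Offset b (bit p) (bit (p xor q)) (bit q)
offset-bit false {false} (inj₁ refl)         = refl
offset-bit false {true}  (inj₁ refl)         = refl
offset-bit false         (inj₂ (refl , refl)) = refl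
offset-bit true  {false} (inj₁ refl)         = refl
offset-bit true  {true}  (inj₁ refl)         = refl
offset-bit true          (inj₂ (refl , refl)) = refl

ones-offset : ∀ {b x y} → ChangesFrom b x y → ∀ n → Offset b (ones x n) (ones (diff x y) n) (ones y n)
ones-offset {false} changes zero    = refl
ones-offset {true}  changes zero    = refl
ones-offset {b}     changes (suc n) = offset-+ b (ones-offset changes n) (offset-bit b (changes n))

toggleBelow : ℕ → Cantor → Cantor
toggleBelow zero    x = x
toggleBelow (suc a) x = toggleBelow a (toggle x a)

toggleBelow-≥ : ∀ a x {j} → a ≤ j → toggleBelow a x j ≡ x j
toggleBelow-≥ zero    x _     = refl
toggleBelow-≥ (suc a) x a<j = trans (toggleBelow-≥ a (toggle x a) (<⇒≤ a<j)) (toggle-away x (>⇒≢ a<j))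

toggleBelow-< : ∀ a x {j} → j < a → toggleBelow a x j ≡ not (x j)
toggleBelow-< (suc a) x {j} j<1+a with j ≟ a
... | yes refl = trans (toggleBelow-≥ j (toggle x j) ≤-refl) (toggle-at x j)
... | no j≢a   = trans (toggleBelow-< a (toggle x a) (≤∧≢⇒< (≤-pred j<1+a) j≢a)) (cong not (toggle-away x j≢a))

toggleBelow-resp : ∀ a {x y} → x ≈ y → toggleBelow a x ≈ toggleBelow a y
toggleBelow-resp zero    x≈y = x≈y
toggleBelow-resp (suc a) x≈y = toggleBelow-resp a (toggle-resp a x≈y)

toggleBelow-toggle : ∀ a x l → toggleBelow a (toggle x l) ≈ toggle (toggleBelow a x) l
toggleBelow-toggle zero    x l = λ j → refl
toggleBelow-toggle (suc a) x l j =
  trans (toggleBelow-resp a (toggle-comm x l a) j) (toggleBelow-toggle a (toggle x a) l j)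

zeros : Cantor
zeros _ = false

ones-toggleBelow-zeros : ∀ a {n} → a ≤ n → ones (toggleBelow a zeros) n ≡ a
ones-toggleBelow-zeros a a≤n =
  trans (ones-stable (toggleBelow a zeros) (λ j a≤j → toggleBelow-≥ a zeros a≤j) a≤n)
        (ones-all-true (toggleBelow a zeros) a (λ j j<a → toggleBelow-< a zeros j<a))

module ReductionImage {b T T'} {u v : Cantor → Cantor} (cu : Continuous u) (red : Reduction b T T' u v)
                      (u≈v : ∀ x → u x ≈ v x) (T0 : T 0) where

  edge-image : ∀ {x y} → Edge false T x y → Edge b T' (u x) (u y)
  edge-image {x} {y} e = edge-respʳ (λ j → sym (u≈v y j)) (proj₁ (red x y) e)

  edge-preimage : ∀ {x y} → Edge b T' (u x) (u y) → Edge false T x y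
  edge-preimage {x} {y} e = proj₂ (red x y) (edge-respʳ (u≈v y) e)

  -- Raising the bits below a one by one from the top keeps the count of lower ones at 0 ∈ T.
  flips-image : ∀ a z → (∀ j → j < a → z j ≡ false) → Flips b a (u z) (u (toggleBelow a z))
  flips-image zero    z _            = flips-none (λ j → refl)
  flips-image (suc a) z z<1+a≡false =
    flips-step m (EdgeAt.source-bit at-m) (flips-respˡ (EdgeAt.target at-m) (flips-image a (toggle z a) z'<a≡false))
    where
    T-ones-z : T (ones z a)
    T-ones-z = subst T (sym (ones-all-false z a (λ j j<a → z<1+a≡false j (m<n⇒m<1+n j<a)))) T0
    open Σ (edge-image (toggle-edge z (z<1+a≡false a ≤-refl) T-ones-z)) renaming (proj₁ to m; proj₂ to at-m)
    z'<a≡false : ∀ j → j < a → toggle z a j ≡ false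
    z'<a≡false j j<a = trans (toggle-below z j<a) (z<1+a≡false j (m<n⇒m<1+n j<a))

  p : ℕ → Cantor
  p a = toggleBelow a zeros

  U : Cantor
  U = u zeros

  flips-from-U : ∀ a → Flips b a U (u (p a))
  flips-from-U a = flips-image a zeros (λ _ _ → refl)

  module Window (P : ℕ) where
    diff-stable : Eventually (λ n → ∀ a → a ≤ P → ones (diff U (u (p a))) n ≡ a)
    diff-stable = eventually-all≤ P (λ a _ → flips-diff (flips-from-U a))

    R : ℕ
    R = proj₁ diff-stable

    modulus : Eventually (λ M → ∀ a → a ≤ P → ∀ y → AgreeBelow M (p a) y → AgreeBelow R (u (p a)) (u y))
    modulus = eventually-all≤ P (λ a _ → continuity-eventually cu (p a) R)

    M l : ℕ
    M = proj₁ modulus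
    l = M ⊔ P

    ≤l : ∀ {a} → a ≤ P → a ≤ l
    ≤l a≤P = ≤-trans a≤P (m≤n⊔m M P)

    q : ℕ → Cantor
    q a = toggleBelow a (toggle zeros l)

    V : Cantor
    V = u (q 0)

    q≈ : ∀ a → q a ≈ toggle (p a) l
    q≈ a = toggleBelow-toggle a zeros l

    agree-below-R : ∀ a → a ≤ P → AgreeBelow R (u (p a)) (u (q a))
    agree-below-R a a≤P = proj₂ modulus M ≤-refl a a≤P (q a)
      (λ i i<M → sym (trans (q≈ a i) (toggle-below (p a) (<-≤-trans i<M (m≤m⊔n M P)))))

    edge-UV : Edge b T' U V
    edge-UV = edge-image (toggle-edge zeros refl (subst T (sym (ones-all-false zeros l (λ _ _ → refl))) T0))

    β : ℕ
    β = proj₁ edge-UV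

    V≈ : V ≈ toggle U β
    V≈ = EdgeAt.target (proj₂ edge-UV)

    R≤β : R ≤ β
    R≤β with R ≤? β
    ... | yes R≤β = R≤β
    ... | no  R≰β = contradiction (trans (agree-below-R 0 z≤n β (≰⇒> R≰β)) (trans (V≈ β) (toggle-at U β))) (not-¬ refl)

    U-agrees-from-R : ∀ a → a ≤ P → ∀ j → R ≤ j → U j ≡ u (p a) j
    U-agrees-from-R a a≤P = flips-agree-from (flips-from-U a) (proj₂ diff-stable R ≤-refl a a≤P)

    V-agrees-from-R : ∀ a → a ≤ P → ∀ j → R ≤ j → V j ≡ u (q a) j
    V-agrees-from-R a a≤P = flips-agree-from (flips-image a (toggle zeros l) (λ j j<a → toggle-below zeros (<-≤-trans j<a (≤l a≤P))))
      (trans (ones-cong R (λ j j<R → cong₂ _xor_ (sym (agree-below-R 0 z≤n j j<R)) (sym (agree-below-R a a≤P j j<R))))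
             (proj₂ diff-stable R ≤-refl a a≤P))

    -- Below R the images of p a and q a agree, above R they copy those of zeros and toggle zeros l.
    image-q≈ : ∀ a → a ≤ P → u (q a) ≈ toggle (u (p a)) β
    image-q≈ a a≤P = toggle-splice R≤β V≈ (agree-below-R a a≤P) (U-agrees-from-R a a≤P) (V-agrees-from-R a a≤P)

    offset : ∀ a → a ≤ P → Offset b (ones U β) a (ones (u (p a)) β)
    offset a a≤P = subst (λ d → Offset b (ones U β) d (ones (u (p a)) β)) (proj₂ diff-stable β R≤β a a≤P)
                         (ones-offset (flips-changes (flips-from-U a)) β)

    forward : ∀ a → a ≤ P → T a → T' (ones (u (p a)) β)
    forward a a≤P Ta = EdgeAt.count (Edge⇒EdgeAt (edge-image edge-pq) (image-q≈ a a≤P))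
      where
      edge-pq : Edge false T (p a) (q a)
      edge-pq = edge-respʳ (λ j → sym (q≈ a j))
        (toggle-edge (p a) (toggleBelow-≥ a zeros (≤l a≤P)) (subst T (sym (ones-toggleBelow-zeros a (≤l a≤P))) Ta))

    backward : ∀ a → a ≤ P → T' (ones (u (p a)) β) → T a
    backward a a≤P T'c = subst T (ones-toggleBelow-zeros a (≤l a≤P))
      (EdgeAt.count (Edge⇒EdgeAt (edge-preimage (β , edgeAt bit-β (image-q≈ a a≤P) T'c)) (q≈ a)))
      where
      bit-β : u (p a) β ≡ b
      bit-β = trans (sym (U-agrees-from-R a a≤P β R≤β)) (EdgeAt.source-bit (proj₂ edge-UV))

  window : ∀ P → ∃ λ κ → ∀ a → a ≤ P → ∃ λ c → Offset b κ a c × (T a ⇔ T' c)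
  window P = ones U β , λ a a≤P → ones (u (p a)) β , offset a a≤P , mk⇔ (forward a a≤P) (backward a a≤P)
    where open Window P

window-shift : ∀ {T T' u v} → Continuous u → Continuous v → Reduction false T T' u v → Infinite T → T 0 →
  ∀ P → ∃ λ κ → ∀ a → a ≤ P → T a ⇔ T' (κ + a)
window-shift {T} {T'} cu cv red infT T0 P =
  κ , λ a a≤P → let c , c≡κ+a , Ta⇔T'c = w a a≤P in subst (λ c → T a ⇔ T' c) c≡κ+a Ta⇔T'c
  where
  open Σ (ReductionImage.window cu red (reduction-diagonal cu cv red infT) T0 P) renaming (proj₁ to κ; proj₂ to w)

window-reflect : ∀ {T T' u v} → Continuous u → Continuous v → Reduction true T T' u v → Infinite T → T 0 →
  ∀ P → ∃ λ g → ∀ a a' → a + a' ≡ P → T a ⇔ T' (g + a')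
window-reflect {T} {T'} cu cv red infT T0 P = g , λ a a' a+a'≡P →
  let c , c+a≡κ , Ta⇔T'c = w a (subst (a ≤_) a+a'≡P (m≤m+n a a'))
  in subst (λ c → T a ⇔ T' c) (+-cancelʳ-≡ a c (g + a') (trans c+a≡κ (sym (g+a'+a≡κ a a' a+a'≡P)))) Ta⇔T'c
  where
  open Σ (ReductionImage.window cu red (reduction-diagonal cu cv red infT) T0 P) renaming (proj₁ to κ; proj₂ to w)
  g : ℕ
  g = proj₁ (w P ≤-refl)
  g+a'+a≡κ : ∀ a a' → a + a' ≡ P → g + a' + a ≡ κ
  g+a'+a≡κ a a' a+a'≡P = trans (+-assoc g a' a) (trans (cong (g +_) (trans (+-comm a' a) a+a'≡P)) (proj₁ (proj₂ (w P ≤-refl))))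

⊕-≐-intro : ∀ {S S' p c} → (∀ j → j ≤ p → S j ⇔ S' (c + j)) → (c ⊕ (S ∩ [0, p ])) ≐ (S' ∩ (c ⊕ [0, p ]))
⊕-≐-intro {S} {S'} shifted n =
  (λ { (m , (Sm , m≤p) , refl) → Equivalence.to (shifted m m≤p) Sm , m , m≤p , refl }) ,
  (λ { (S'n , m , m≤p , refl) → m , (Equivalence.from (shifted m m≤p) S'n , m≤p) , refl })

⊕-≐-elim : ∀ {S S' p c} → (c ⊕ (S ∩ [0, p ])) ≐ (S' ∩ (c ⊕ [0, p ])) → ∀ j → j ≤ p → S j ⇔ S' (c + j)
⊕-≐-elim {S} {S'} {p} {c} S≐S' j j≤p = mk⇔
  (λ Sj → proj₁ (proj₁ (S≐S' (c + j)) (j , (Sj , j≤p) , refl)))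
  (λ S'c+j → let m , (Sm , _) , c+j≡c+m = proj₂ (S≐S' (c + j)) (S'c+j , j , j≤p , refl)
             in subst S (sym (+-cancelˡ-≡ c j m c+j≡c+m)) Sm)

+[m+n]-+m≡+n : ∀ m n → (ℤ.+ (m + n)) - (ℤ.+ m) ≡ ℤ.+ n
+[m+n]-+m≡+n m n = begin
  (ℤ.+ (m + n)) - (ℤ.+ m)  ≡⟨ ℤₚ.[+m]-[+n]≡m⊖n (m + n) m ⟩
  (m + n) ℤ.⊖ m            ≡⟨ cong ((m + n) ℤ.⊖_) (+-identityʳ m) ⟨
  (m + n) ℤ.⊖ (m + 0)      ≡⟨ ℤₚ.+-cancelˡ-⊖ m n 0 ⟩
  ℤ.+ n                    ∎
  where open ≡-Reasoning

⊖-≐-intro : ∀ {S S' p c} → (∀ j j' → j + j' ≡ p → S j ⇔ S' (c + j')) →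
  ((c + p) ⊖ (S ∩ [0, p ])) ≐ᶻ (toZ S' ∩ᶻ ((c + p) ⊖ [0, p ]))
⊖-≐-intro {S} {S'} {p} {c} reflected z =
  (λ { (m , (Sm , m≤p) , z≡) → (c + rest m≤p , Equivalence.to (reflected m _ (splits m≤p)) Sm , trans z≡ (centre m≤p)) ,
                                (m , m≤p , z≡) }) ,
  (λ { ((n , S'n , z≡n) , m , m≤p , z≡) →
         m , (Equivalence.from (reflected m _ (splits m≤p)) (subst S' (ℤₚ.+-injective (trans (sym z≡n) (trans z≡ (centre m≤p)))) S'n) , m≤p) , z≡ })
  where
  rest : ∀ {m} → m ≤ p → ℕ
  rest m≤p = proj₁ (m≤n⇒∃[o]m+o≡n m≤p)
  splits : ∀ {m} (m≤p : m ≤ p) → m + rest m≤p ≡ p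
  splits m≤p = proj₂ (m≤n⇒∃[o]m+o≡n m≤p)
  centre : ∀ {m} (m≤p : m ≤ p) → (ℤ.+ (c + p)) - (ℤ.+ m) ≡ ℤ.+ (c + rest m≤p)
  centre {m} m≤p = begin
    (ℤ.+ (c + p)) - (ℤ.+ m)              ≡⟨ cong (λ k → (ℤ.+ (c + k)) - (ℤ.+ m)) (splits m≤p) ⟨
    (ℤ.+ (c + (m + rest m≤p))) - (ℤ.+ m) ≡⟨ cong (λ k → (ℤ.+ k) - (ℤ.+ m)) (x∙yz≈y∙xz c m (rest m≤p)) ⟩
    (ℤ.+ (m + (c + rest m≤p))) - (ℤ.+ m) ≡⟨ +[m+n]-+m≡+n m (c + rest m≤p) ⟩
    ℤ.+ (c + rest m≤p)                   ∎
    where open ≡-Reasoning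

NoShiftedCopy : Subset → Subset → Set
NoShiftedCopy S S' = Σ ℕ λ p → ∀ c → ¬ ((c ⊕ (S ∩ [0, p ])) ≐ (S' ∩ (c ⊕ [0, p ])))

NoReflectedCopy : Subset → Subset → Set
NoReflectedCopy S S' = Σ ℕ λ p → ∀ c → ¬ ((c ⊖ (S ∩ [0, p ])) ≐ᶻ (toZ S' ∩ᶻ (c ⊖ [0, p ])))

recurrence : ∀ {S} → CondM S → ∀ p → ∃ λ K → ∀ q → ∃ λ d → d ≤ K × (∀ j → j ≤ p → S j ⇔ S (q + d + j))
recurrence {S} recS p with recS p
... | K , recurrent = K , λ q → copy-after q (recurrent q)
  where
  copy-after : ∀ q → (∃ λ c → q ≤ c × c ≤ q + K × (c ⊕ (S ∩ [0, p ])) ≐ (S ∩ (c ⊕ [0, p ]))) →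
               ∃ λ d → d ≤ K × (∀ j → j ≤ p → S j ⇔ S (q + d + j))
  copy-after q (c , q≤c , c≤q+K , S≐S) with m≤n⇒∃[o]m+o≡n q≤c
  ... | d , refl = d , +-cancelˡ-≤ q d K c≤q+K , ⊕-≐-elim S≐S

¬A^≤rc-A^ : ∀ {S S'} → Infinite S → S 0 → NoShiftedCopy S S' → ¬ (A^ S ≤rc A^ S')
¬A^≤rc-A^ {S} {S'} infS S0 (p , no-copy) (u , v , cu , cv , red) = no-copy κ (⊕-≐-intro S⇔S')
  where open Σ (window-shift cu cv (reduction-A^ {S} {S'} red) infS S0 p) renaming (proj₁ to κ; proj₂ to S⇔S')

¬A^≤rc-A^⁻¹ : ∀ {S S'} → Infinite S → S 0 → NoReflectedCopy S S' → ¬ (A^ S ≤rc (A^ S' ⁻¹))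
¬A^≤rc-A^⁻¹ {S} {S'} infS S0 (p , no-copy) (u , v , cu , cv , red) = no-copy (g + p) (⊖-≐-intro S⇔S')
  where open Σ (window-reflect cu cv (reduction-A^⁻¹ {S} {S'} red) infS S0 p) renaming (proj₁ to g; proj₂ to S⇔S')

¬A^≤rc-A^-recurrent : ∀ {S S'} → Infinite S' → S' 0 → CondM S → NoShiftedCopy S S' → ¬ (A^ S' ≤rc A^ S)
¬A^≤rc-A^-recurrent {S} {S'} infS' S'0 recS (p , no-copy) (u , v , cu , cv , red) = no-copy d (⊕-≐-intro copy)
  where
  open Σ (recurrence recS p) renaming (proj₁ to K; proj₂ to recurrent)
  open Σ (window-shift cu cv (reduction-A^ {S'} {S} red) infS' S'0 (K + p)) renaming (proj₁ to κ; proj₂ to S'⇔S)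
  open Σ (recurrent κ) renaming (proj₁ to d; proj₂ to d≤K×S⇔S)
  copy : ∀ j → j ≤ p → S j ⇔ S' (d + j)
  copy j j≤p = begin
    S j             ≈⟨ proj₂ d≤K×S⇔S j j≤p ⟩
    S (κ + d + j)   ≡⟨ cong S (+-assoc κ d j) ⟩
    S (κ + (d + j)) ≈⟨ S'⇔S (d + j) (+-mono-≤ (proj₁ d≤K×S⇔S) j≤p) ⟨
    S' (d + j)      ∎
    where open SetoidReasoning (⇔-setoid 0ℓ)

¬A^⁻¹≤rc-A^-recurrent : ∀ {S S'} → Infinite S' → S' 0 → CondM S → NoReflectedCopy S S' → ¬ ((A^ S' ⁻¹) ≤rc A^ S)
¬A^⁻¹≤rc-A^-recurrent {S} {S'} infS' S'0 recS (p , no-copy) (u , v , cu , cv , red) = no-copy (e' + p) (⊖-≐-intro copy)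
  where
  open Σ (recurrence recS p) renaming (proj₁ to K; proj₂ to recurrent)
  open Σ (window-reflect cv cu (reduction-⁻¹A^ {S'} {S} red) infS' S'0 (K + p)) renaming (proj₁ to g; proj₂ to S'⇔S)
  open Σ (recurrent g) renaming (proj₁ to e; proj₂ to e≤K×S⇔S)
  open Σ (m≤n⇒∃[o]m+o≡n (proj₁ e≤K×S⇔S)) renaming (proj₁ to e'; proj₂ to e+e'≡K)
  indices-sum : ∀ j j' → j + j' ≡ p → e' + j' + (e + j) ≡ K + p
  indices-sum j j' j+j'≡p = begin
    e' + j' + (e + j) ≡⟨ interchange e' j' e j ⟩
    e' + e + (j' + j) ≡⟨ cong₂ _+_ (+-comm e' e) (+-comm j' j) ⟩
    e + e' + (j + j') ≡⟨ cong₂ _+_ e+e'≡K j+j'≡p ⟩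
    K + p             ∎
    where open ≡-Reasoning
  copy : ∀ j j' → j + j' ≡ p → S j ⇔ S' (e' + j')
  copy j j' j+j'≡p = begin
    S j             ≈⟨ proj₂ e≤K×S⇔S j (subst (j ≤_) j+j'≡p (m≤m+n j j')) ⟩
    S (g + e + j)   ≡⟨ cong S (+-assoc g e j) ⟩
    S (g + (e + j)) ≈⟨ S'⇔S (e' + j') (e + j) (indices-sum j j' j+j'≡p) ⟨
    S' (e' + j')    ∎
    where open SetoidReasoning (⇔-setoid 0ℓ)

-- The recurrence condition (M) is needed for S only.
theorem23 : (S S' : Subset) →
    Infinite S → Infinite S' → S 0 → S' 0 → CondM S → CondM S' →
    ((Σ ℕ λ p → ∀ c → ¬ ((c ⊕ (S ∩ [0, p ])) ≐ (S' ∩ (c ⊕ [0, p ])))) →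
      ¬ (A^ S ≤rc A^ S') × ¬ (A^ S' ≤rc A^ S))
    × ((Σ ℕ λ p → ∀ c → ¬ ((c ⊖ (S ∩ [0, p ])) ≐ᶻ (toZ S' ∩ᶻ (c ⊖ [0, p ])))) →
      ¬ (A^ S ≤rc (A^ S' ⁻¹)) × ¬ ((A^ S' ⁻¹) ≤rc A^ S))
theorem23 S S' infS infS' S0 S'0 recS _ =
  (λ no-shift → ¬A^≤rc-A^ {S} {S'} infS S0 no-shift , ¬A^≤rc-A^-recurrent {S} {S'} infS' S'0 recS no-shift) ,
  (λ no-reflection → ¬A^≤rc-A^⁻¹ {S} {S'} infS S0 no-reflection ,
                     ¬A^⁻¹≤rc-A^-recurrent {S} {S'} infS' S'0 recS no-reflection)
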